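{- Every polyregular function is equal to a finite composition of transductions each specified by an HDT0L system.
   Context: Register transducer $\Gamma^*\to\Sigma^*$ (finite alphabets): a finite set $Q$ of states with initial state $q_I$, a finite set $R$ of registers disjoint from $\Gamma,\Sigma$, a transition function $\delta:Q\times\Gamma\to Q\times((\Sigma\cup R)^*)^R$ and an output function $F:Q\to(\Sigma\cup R)^*$. Configurations are pairs $(q,s)$ with $s:R\to\Sigma^*$; for $c\in\Gamma$, $(q,s)\to_c(q',s')$ when $(q',u)=\delta(q,c)$ and $s'=s^*\circ u$, where $s^*$ is the monoid morphism fixing letters of $\Sigma$ and sending $r$ to $s(r)$. The image of $w=w_1\cdots w_n$ is $s^*(F(q))$ where $(q_I,(r\mapsto\varepsilon))\to_{w_1}\cdots\to_{w_n}(q,s)$. A streaming string transducer (SST) is a register transducer such that for every update $u$ appearing in some $\delta(q,c)$ and every $r\in R$, $r$ occurs at most once in total among the words $u(r')$, $r'\in R$, and every $r$ occurs at most once in each $F(q)$. A function is regular if computed by some SST. For a finite alphabet $\Gamma$, let $\underline\Gamma=\{\underline c\mid c\in\Gamma\}$ be a disjoint copy; $\mathtt{squaring}_\Gamma:\Gamma^*\to(\Gamma\cup\underline\Gamma)^*$ maps $w=w_1\cdots w_n$ to the concatenation, for $i=1,\dots,n$, of the word $w_1\cdots w_{i-1}\underline{w_i}w_{i+1}\cdots w_n$ (e.g. $\mathtt{1234}\mapsto\mathtt{\underline{1}2341\underline{2}3412\underline{3}4123\underline{4}}$). The polyregular functions form the smallest class of string functions closed under composition containing all regular functions and all $\mathtt{squaring}_\Gamma$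 for finite $\Gamma$. An HDT0L system consists of finite alphabets $\Gamma,\Sigma,\Delta$, an initial word $d\in\Delta^*$, monoid morphisms $h_c:\Delta^*\to\Delta^*$ ($c\in\Gamma$) and $h':\Delta^*\to\Sigma^*$; it specifies $w_1\cdots w_n\mapsto h'\circ h_{w_1}\circ\cdots\circ h_{w_n}(d)$. -}

module Defs where

open import Data.Nat using (ℕ; zero; suc; _+_; _≤_)
open import Data.Fin using (Fin; _≟_; join)
open import Data.Fin.Base using ()
open import Data.List using (List; []; _∷_; map; concatMap; upTo; length; foldr; allFin)
open import Data.Nat.ListAction using (sum)
open import Data.Sum using (_⊎_; inj₁; inj₂; [_,_])
open import Data.Product using (_×_; _,_; proj₁; proj₂; Σ; ∃)
open import Data.Bool using (if_then_else_)
open import Relation.Nullary using (does)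
open import Relation.Binary.PropositionalEquality using (_≡_)

Word : ℕ → Set
Word n = List (Fin n)

StrFun : ℕ → ℕ → Set
StrFun n m = Word n → Word m

-- Register transducers / SSTs
-- Γ = Fin g (input), Σ = Fin s (output), Q = Fin k (states), R = Fin m (registers).
-- Letters of (Σ ∪ R) are inj₁ a (a ∈ Σ) and inj₂ r (r ∈ R).

record RegisterTransducer (g s : ℕ) : Set where
  field
    nStates : ℕ
    nRegs   : ℕ
    qI      : Fin nStates
    δ       : Fin nStates → Fin g → Fin nStates × (Fin nRegs → List (Fin s ⊎ Fin nRegs))
    F       : Fin nStates → List (Fin s ⊎ Fin nRegs)

substReg : ∀ {s m} → (Fin m → List (Fin s)) → List (Fin s ⊎ Fin m) → List (Fin s)
substReg val = concatMap [ (λ a → a ∷ []) , val ]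

module _ {g s : ℕ} (T : RegisterTransducer g s) where
  open RegisterTransducer T

  Config : Set
  Config = Fin nStates × (Fin nRegs → List (Fin s))

  step : Config → Fin g → Config
  step (q , val) c = proj₁ (δ q c) , (λ r → substReg val (proj₂ (δ q c) r))

  runFrom : Config → Word g → Config
  runFrom cfg [] = cfg
  runFrom cfg (c ∷ w) = runFrom (step cfg c) w

  initConfig : Config
  initConfig = qI , (λ _ → [])

  ⟦_⟧RT : Word g → Word s
  ⟦_⟧RT w = substReg (proj₂ (runFrom initConfig w)) (F (proj₁ (runFrom initConfig w)))

occ : ∀ {s m} → Fin m → List (Fin s ⊎ Fin m) → ℕ
occ r [] = 0
occ r (inj₁ _ ∷ xs) = occ r xs
occ r (inj₂ r' ∷ xs) = (if does (r ≟ r') then 1 else 0) + occ r xs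

IsSST : ∀ {g s} → RegisterTransducer g s → Set
IsSST T =
  (∀ q c r → sum (map (λ r' → occ r (proj₂ (δ q c) r')) (allFin nRegs)) ≤ 1)
  × (∀ q r → occ r (F q) ≤ 1)
  where open RegisterTransducer T

Regular : ∀ {n m} → StrFun n m → Set
Regular {n} {m} f = Σ (RegisterTransducer n m) λ T → IsSST T × (∀ w → ⟦ T ⟧RT w ≡ f w)

-- squaring_Γ : Γ* → (Γ ∪ Γ̲)*.  Γ ∪ Γ̲ is Fin n ⊎ Fin n (inj₂ = underlined),
-- encoded as Fin (n + n) via Data.Fin.join.

underlineAt : ∀ {n} → ℕ → Word n → List (Fin n ⊎ Fin n)
underlineAt i [] = []
underlineAt zero (c ∷ w) = inj₂ c ∷ map inj₁ w
underlineAt (suc i) (c ∷ w) = inj₁ c ∷ underlineAt i w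

squaring : (n : ℕ) → StrFun n (n + n)
squaring n w = map (join n n) (concatMap (λ i → underlineAt i w) (upTo (length w)))

data Polyregular : {n m : ℕ} → StrFun n m → Set where
  reg  : ∀ {n m} {f : StrFun n m} → Regular f → Polyregular f
  sq   : ∀ {n} {f : StrFun n (n + n)} → (∀ w → f w ≡ squaring n w) → Polyregular f
  comp : ∀ {n k m} {f : StrFun n m} {g : StrFun n k} {h : StrFun k m} →
         Polyregular g → Polyregular h → (∀ w → f w ≡ h (g w)) → Polyregular f

-- HDT0L systems: Γ = Fin g, Σ = Fin s, Δ = Fin d.
-- A morphism Δ* → X* is given by the images of letters.

record HDT0L (g s : ℕ) : Set where
  field
    d    : ℕ
    init : List (Fin d)
    h    : Fin g → Fin d → List (Fin d)
    h'   : Fin d → List (Fin s)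

morph : ∀ {a b} → (Fin a → List (Fin b)) → List (Fin a) → List (Fin b)
morph φ = concatMap φ

⟦_⟧H : ∀ {g s} → HDT0L g s → StrFun g s
⟦ H ⟧H w = morph h' (foldr (λ c u → morph (h c) u) init w)
  where open HDT0L H

HDT0LFun : ∀ {n m} → StrFun n m → Set
HDT0LFun {n} {m} f = Σ (HDT0L n m) λ H → ∀ w → ⟦ H ⟧H w ≡ f w

data HDT0LComposition : {n m : ℕ} → StrFun n m → Set where
  single : ∀ {n m} {f : StrFun n m} → HDT0LFun f → HDT0LComposition f
  after  : ∀ {n k m} {f : StrFun n m} {g : StrFun n k} {h : StrFun k m} →
           HDT0LComposition g → HDT0LFun h → (∀ w → f w ≡ h (g w)) → HDT0LComposition f

-- An HDT0L system over any finite alphabet can be re-encoded over some Fin k,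
-- so structured alphabets may be used throughout.
--
-- Every register transducer T, copyless or not, is an HDT0L system over the
-- alphabet Q × (Σ ∪ R).  The word h_{w₁} ∘ ⋯ ∘ h_{wₙ}(d) lists, for every state
-- q, the output of the run of T from q on w, as a word over Σ ∪ R whose letters
-- are tagged with q: prepending a letter c replaces each letter tagged p′ by its
-- c-update tagged p, for every p with δ(p, c) = p′.  Substituting register
-- values and keeping the letters tagged with the current state then yields the
-- output of the run from any configuration.
--
-- Squaring is the composition of three HDT0L systems: the reversal (which is
-- regular), the map w ↦ w̲₁w₂⋯wₙ w̲₂w₃⋯wₙ ⋯ w̲ₙ applied to the reversed word, so
-- that it reads w from left to right, and the insertion in front of every
-- underlined letter of all earlier underlined letters.  Since HDT0L
-- compositions compose, the theorem follows by induction on polyregularity.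
module Submission where

open import Defs
open import Data.Bool using (Bool; true; false)
open import Data.Fin using (Fin; zero; suc; _≟_; join; splitAt)
open import Data.Fin.Properties using (splitAt-join; +↔⊎; *↔×)
open import Data.List
  using (List; []; _∷_; _++_; [_]; _∷ʳ_; map; concat; concatMap; foldr; reverse; length; applyUpTo; upTo; allFin)
open import Data.List.Properties
  using ( ++-assoc; ++-identityʳ; map-++; map-∘; map-cong; map-id; map-tabulate; concatMap-cong; concatMap-map
        ; map-concatMap; concatMap-++; concatMap-pure; length-++; unfold-reverse; reverse-involutive)
open import Data.List.Effectful using (module MonadProperties)
open import Data.Nat using (ℕ; zero; suc; _+_; _*_)
open import Data.Nat.Properties using (+-assoc)
open import Data.Product using (_×_; _,_; proj₁; proj₂; Σ)
open import Data.Product.Function.NonDependent.Propositional using (_×-↔_)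
open import Data.Sum using (_⊎_; inj₁; inj₂; [_,_])
open import Data.Sum.Function.Propositional using (_⊎-↔_)
open import Function using (_∘_; id; _↔_; Inverse; mk↔ₛ′)
open import Function.Properties.Inverse using (↔-refl; ↔-sym; ↔-trans)
open import Relation.Nullary using (does)
open import Relation.Binary.PropositionalEquality
  using (_≡_; _≗_; refl; sym; trans; cong; cong₂; module ≡-Reasoning)

open MonadProperties using (associative; right-zero)

when : {A : Set} → Bool → List A → List A
when true  xs = xs
when false _  = []

module _ {A B : Set} where

  concatMap-singleton : (f : A → B) → concatMap ([_] ∘ f) ≗ map f
  concatMap-singleton f xs = trans (sym (concatMap-map [_] f xs)) (concatMap-pure (map f xs))

  concatMap-when : ∀ (f : A → List B) b xs → concatMap f (when b xs) ≡ when b (concatMap f xs)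
  concatMap-when f true  xs = refl
  concatMap-when f false xs = refl

  concatMap-const-when : ∀ b (f : A → List B) xs →
                         concatMap (λ x → when b (f x)) xs ≡ when b (concatMap f xs)
  concatMap-const-when true  f xs = refl
  concatMap-const-when false f xs = right-zero xs

when-comm : ∀ {A : Set} a b (xs : List A) → when a (when b xs) ≡ when b (when a xs)
when-comm true  true  xs = refl
when-comm true  false xs = refl
when-comm false true  xs = refl
when-comm false false xs = refl

concatMap-allFin-suc : ∀ {A : Set} {k} (f : Fin (suc k) → List A) →
                       concatMap f (allFin (suc k)) ≡ f zero ++ concatMap (f ∘ suc) (allFin k)
concatMap-allFin-suc f =
  cong (λ fs → f zero ++ concat fs) (trans (map-tabulate suc f) (sym (map-tabulate id (f ∘ suc))))

concatMap-allFin-when-≟ : ∀ {A : Set} {k} (X : Fin k → List A) q →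
                          concatMap (λ p → when (does (p ≟ q)) (X p)) (allFin k) ≡ X q
concatMap-allFin-when-≟ {k = suc k} X zero =
  trans (concatMap-allFin-suc (λ p → when (does (p ≟ zero)) (X p)))
        (trans (cong (X zero ++_) (right-zero (allFin k))) (++-identityʳ (X zero)))
concatMap-allFin-when-≟ X (suc q) =
  trans (concatMap-allFin-suc (λ p → when (does (p ≟ suc q)) (X p))) (concatMap-allFin-when-≟ (X ∘ suc) q)

applyUpTo-cong : ∀ {A : Set} {f g : ℕ → A} → f ≗ g → ∀ m → applyUpTo f m ≡ applyUpTo g m
applyUpTo-cong f≗g zero    = refl
applyUpTo-cong f≗g (suc m) = cong₂ _∷_ (f≗g 0) (applyUpTo-cong (f≗g ∘ suc) m)

Finite : Set → Set
Finite Δ = Σ ℕ λ k → Δ ↔ Fin k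

finite-Fin : ∀ k → Finite (Fin k)
finite-Fin k = k , ↔-refl

finite-⊎ : ∀ {A B : Set} → Finite A → Finite B → Finite (A ⊎ B)
finite-⊎ (k , A↔k) (l , B↔l) = k + l , ↔-trans (A↔k ⊎-↔ B↔l) (↔-sym +↔⊎)

finite-× : ∀ {A B : Set} → Finite A → Finite B → Finite (A × B)
finite-× (k , A↔k) (l , B↔l) = k * l , ↔-trans (A↔k ×-↔ B↔l) (↔-sym *↔×)

applyMorphisms : ∀ {Δ : Set} {g} → (Fin g → Δ → List Δ) → List Δ → Word g → List Δ
applyMorphisms h d = foldr (λ c → concatMap (h c)) d

HDT0LFun-overFinite : ∀ {Δ : Set} {g s} {f : StrFun g s} → Finite Δ →
                      (d : List Δ) (h : Fin g → Δ → List Δ) (h′ : Δ → List (Fin s)) →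
                      (∀ w → concatMap h′ (applyMorphisms h d w) ≡ f w) → HDT0LFun f
HDT0LFun-overFinite {g = g} {s} (k , Δ↔k) d h h′ correct = H , λ w → trans (encode-correct w) (correct w)
  where
  open Inverse Δ↔k using (to; from; strictlyInverseʳ)

  encoded : Fin g → Fin k → List (Fin k)
  encoded c = map to ∘ h c ∘ from

  H : HDT0L g s
  H = record { d = k ; init = map to d ; h = encoded ; h' = h′ ∘ from }

  encode-step : ∀ c u → concatMap (encoded c) (map to u) ≡ map to (concatMap (h c) u)
  encode-step c u = begin
      concatMap (encoded c) (map to u)
    ≡⟨ concatMap-map (encoded c) to u ⟩
      concatMap (encoded c ∘ to) u
    ≡⟨ concatMap-cong (cong (map to ∘ h c) ∘ strictlyInverseʳ) u ⟩
      concatMap (map to ∘ h c) u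
    ≡⟨ map-concatMap to (h c) u ⟨
      map to (concatMap (h c) u)
    ∎
    where open ≡-Reasoning

  encode-run : ∀ w → applyMorphisms encoded (map to d) w ≡ map to (applyMorphisms h d w)
  encode-run []      = refl
  encode-run (c ∷ w) = trans (cong (concatMap (encoded c)) (encode-run w)) (encode-step c (applyMorphisms h d w))

  encode-correct : ∀ w → ⟦ H ⟧H w ≡ concatMap h′ (applyMorphisms h d w)
  encode-correct w = trans (cong (concatMap (h′ ∘ from)) (encode-run w))
                           (trans (concatMap-map (h′ ∘ from) to run)
                                  (concatMap-cong (cong h′ ∘ strictlyInverseʳ) run))
    where run = applyMorphisms h d w

HDT0LComposition-cong : ∀ {n m} {f g : StrFun n m} → f ≗ g → HDT0LComposition g → HDT0LComposition f
HDT0LComposition-cong f≗g (single (H , H≗g))   = single (H , λ w → trans (H≗g w) (sym (f≗g w)))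
HDT0LComposition-cong f≗g (after c H f₂≗H∘f₁) = after c H (λ w → trans (f≗g w) (f₂≗H∘f₁ w))

HDT0LComposition-∘ : ∀ {n k m} {f : StrFun n m} {g : StrFun n k} {h : StrFun k m} →
                     HDT0LComposition g → HDT0LComposition h → (∀ w → f w ≡ h (g w)) → HDT0LComposition f
HDT0LComposition-∘ cg (single H) f≗h∘g = after cg H f≗h∘g
HDT0LComposition-∘ {g = g} cg (after {g = h₁} ch₁ H h≗H∘h₁) f≗h∘g =
  after (HDT0LComposition-∘ {f = h₁ ∘ g} cg ch₁ (λ _ → refl)) H
        (λ w → trans (f≗h∘g w) (h≗H∘h₁ (g w)))

module FromRegisterTransducer {g s : ℕ} (T : RegisterTransducer g s) where
  open RegisterTransducer T

  Letter : Set
  Letter = Fin s ⊎ Fin nRegs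

  Δ : Set
  Δ = Fin nStates × Letter

  states : List (Fin nStates)
  states = allFin nStates

  value : (Fin nRegs → List (Fin s)) → Letter → List (Fin s)
  value val = [ [_] ,_] val

  update : Fin nStates → Fin g → Letter → List Letter
  update p c = [ [_] ∘ inj₁ ,_] (proj₂ (δ p c))

  target : Fin nStates → Fin g → Fin nStates
  target p c = proj₁ (δ p c)

  output : Config T → List (Fin s)
  output cfg = substReg (proj₂ cfg) (F (proj₁ cfg))

  tag : Fin nStates → List Letter → List Δ
  tag p = map (p ,_)

  initial : List Δ
  initial = concatMap (λ q → tag q (F q)) states

  morphism : Fin g → Δ → List Δ
  morphism c (p′ , x) = concatMap (λ p → when (does (p′ ≟ target p c)) (tag p (update p c x))) states

  evalAt : Config T → Δ → List (Fin s)
  evalAt (q , val) (p , x) = when (does (p ≟ q)) (value val x)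

  evalAt-tag : ∀ q val p u → concatMap (evalAt (q , val)) (tag p u) ≡ when (does (p ≟ q)) (substReg val u)
  evalAt-tag q val p u = trans (concatMap-map (evalAt (q , val)) (p ,_) u) (concatMap-const-when _ (value val) u)

  evalAt-initial : ∀ cfg → concatMap (evalAt cfg) initial ≡ output cfg
  evalAt-initial (q , val) = begin
      concatMap (evalAt (q , val)) (concatMap (λ p → tag p (F p)) states)
    ≡⟨ associative states (λ p → tag p (F p)) (evalAt (q , val)) ⟨
      concatMap (λ p → concatMap (evalAt (q , val)) (tag p (F p))) states
    ≡⟨ concatMap-cong (λ p → evalAt-tag q val p (F p)) states ⟩
      concatMap (λ p → when (does (p ≟ q)) (substReg val (F p))) states
    ≡⟨ concatMap-allFin-when-≟ (λ p → substReg val (F p)) q ⟩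
      substReg val (F q)
    ∎
    where open ≡-Reasoning

  evalAt-morphism : ∀ cfg c y → concatMap (evalAt cfg) (morphism c y) ≡ evalAt (step T cfg c) y
  evalAt-morphism (q , val) c (p′ , x) = begin
      concatMap (evalAt (q , val)) (concatMap (λ p → when (enters p) (tag p (update p c x))) states)
    ≡⟨ associative states _ (evalAt (q , val)) ⟨
      concatMap (λ p → concatMap (evalAt (q , val)) (when (enters p) (tag p (update p c x)))) states
    ≡⟨ concatMap-cong evalAt-guarded states ⟩
      concatMap (λ p → when (enters p) (when (does (p ≟ q)) (updated p))) states
    ≡⟨ concatMap-cong (λ p → when-comm (enters p) (does (p ≟ q)) (updated p)) states ⟩
      concatMap (λ p → when (does (p ≟ q)) (when (enters p) (updated p))) states
    ≡⟨ concatMap-allFin-when-≟ (λ p → when (enters p) (updated p)) q ⟩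
      when (enters q) (updated q)
    ≡⟨ cong (when (enters q)) (substReg-update x) ⟩
      evalAt (step T (q , val) c) (p′ , x)
    ∎
    where
    open ≡-Reasoning

    enters : Fin nStates → Bool
    enters p = does (p′ ≟ target p c)

    updated : Fin nStates → List (Fin s)
    updated p = substReg val (update p c x)

    evalAt-guarded : ∀ p → concatMap (evalAt (q , val)) (when (enters p) (tag p (update p c x)))
                         ≡ when (enters p) (when (does (p ≟ q)) (updated p))
    evalAt-guarded p = trans (concatMap-when (evalAt (q , val)) (enters p) (tag p (update p c x)))
                             (cong (when (enters p)) (evalAt-tag q val p (update p c x)))

    substReg-update : ∀ x → substReg val (update q c x) ≡ value (proj₂ (step T (q , val) c)) x
    substReg-update (inj₁ a) = refl
    substReg-update (inj₂ r) = refl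

  evalAt-run : ∀ w cfg → concatMap (evalAt cfg) (applyMorphisms morphism initial w) ≡ output (runFrom T cfg w)
  evalAt-run []      cfg = evalAt-initial cfg
  evalAt-run (c ∷ w) cfg = begin
      concatMap (evalAt cfg) (concatMap (morphism c) run)
    ≡⟨ associative run (morphism c) (evalAt cfg) ⟨
      concatMap (λ y → concatMap (evalAt cfg) (morphism c y)) run
    ≡⟨ concatMap-cong (evalAt-morphism cfg c) run ⟩
      concatMap (evalAt (step T cfg c)) run
    ≡⟨ evalAt-run w (step T cfg c) ⟩
      output (runFrom T (step T cfg c) w)
    ∎
    where
    open ≡-Reasoning
    run = applyMorphisms morphism initial w

  finite-Δ : Finite Δ
  finite-Δ = finite-× (finite-Fin nStates) (finite-⊎ (finite-Fin s) (finite-Fin nRegs))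

  registerTransducer⇒HDT0L : HDT0LFun ⟦ T ⟧RT
  registerTransducer⇒HDT0L =
    HDT0LFun-overFinite finite-Δ initial morphism (evalAt (initConfig T)) (λ w → evalAt-run w (initConfig T))

open FromRegisterTransducer using (registerTransducer⇒HDT0L)

reversal : ∀ n → RegisterTransducer n n
reversal n = record
  { nStates = 1
  ; nRegs   = 1
  ; qI      = zero
  ; δ       = λ _ c → zero , λ r → inj₁ c ∷ inj₂ r ∷ []
  ; F       = λ _ → [ inj₂ zero ]
  }

reversal-runFrom : ∀ {n} (w : Word n) cfg →
                   proj₂ (runFrom (reversal n) cfg w) zero ≡ reverse w ++ proj₂ cfg zero
reversal-runFrom []      cfg       = refl
reversal-runFrom (c ∷ w) (q , val) = begin
    proj₂ (runFrom (reversal _) (step (reversal _) (q , val) c) w) zero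
  ≡⟨ reversal-runFrom w _ ⟩
    reverse w ++ c ∷ (val zero ++ [])
  ≡⟨ cong (λ u → reverse w ++ c ∷ u) (++-identityʳ (val zero)) ⟩
    reverse w ++ c ∷ val zero
  ≡⟨ ++-assoc (reverse w) [ c ] (val zero) ⟨
    (reverse w ∷ʳ c) ++ val zero
  ≡⟨ cong (_++ val zero) (unfold-reverse c w) ⟨
    reverse (c ∷ w) ++ val zero
  ∎
  where open ≡-Reasoning

reverse≗⟦reversal⟧ : ∀ {n} → reverse ≗ ⟦ reversal n ⟧RT
reverse≗⟦reversal⟧ {n} w = begin
    reverse w
  ≡⟨ ++-identityʳ (reverse w) ⟨
    reverse w ++ []
  ≡⟨ reversal-runFrom w (initConfig (reversal n)) ⟨
    proj₂ (runFrom (reversal n) (initConfig (reversal n)) w) zero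
  ≡⟨ ++-identityʳ _ ⟨
    ⟦ reversal n ⟧RT w
  ∎
  where open ≡-Reasoning

suffixBlocks : ∀ {X : Set} → List X → List (X ⊎ X)
suffixBlocks []      = []
suffixBlocks (c ∷ w) = inj₂ c ∷ map inj₁ w ++ suffixBlocks w

-- P is the (image of the) prefix to insert before the next underlined letter;
-- every underlined letter read is appended to it as a plain letter.
insertPrefixes : ∀ {X A : Set} → (X ⊎ X → A) → List A → List (X ⊎ X) → List A
insertPrefixes ι P []           = []
insertPrefixes ι P (inj₁ c ∷ v) = ι (inj₁ c) ∷ insertPrefixes ι P v
insertPrefixes ι P (inj₂ c ∷ v) = P ++ ι (inj₂ c) ∷ insertPrefixes ι (P ∷ʳ ι (inj₁ c)) v

insertPrefixes-plain : ∀ {X A : Set} (ι : X ⊎ X → A) P w v →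
                       insertPrefixes ι P (map inj₁ w ++ v) ≡ map (ι ∘ inj₁) w ++ insertPrefixes ι P v
insertPrefixes-plain ι P []      v = refl
insertPrefixes-plain ι P (c ∷ w) v = cong (ι (inj₁ c) ∷_) (insertPrefixes-plain ι P w v)

concatMap-insertPrefixes : ∀ {X A B : Set} (φ : A → List B) (ι : X ⊎ X → A) (ι′ : X ⊎ X → B) →
                           (∀ e → φ (ι e) ≡ [ ι′ e ]) →
                           ∀ P v → concatMap φ (insertPrefixes ι P v) ≡ insertPrefixes ι′ (concatMap φ P) v
concatMap-insertPrefixes φ ι ι′ φι≡ι′ P []           = refl
concatMap-insertPrefixes φ ι ι′ φι≡ι′ P (inj₁ c ∷ v) =
  cong₂ _++_ (φι≡ι′ (inj₁ c)) (concatMap-insertPrefixes φ ι ι′ φι≡ι′ P v)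
concatMap-insertPrefixes φ ι ι′ φι≡ι′ P (inj₂ c ∷ v) = begin
    concatMap φ (P ++ ι (inj₂ c) ∷ insertPrefixes ι P′ v)
  ≡⟨ concatMap-++ φ P _ ⟩
    concatMap φ P ++ φ (ι (inj₂ c)) ++ concatMap φ (insertPrefixes ι P′ v)
  ≡⟨ cong₂ (λ u v → concatMap φ P ++ u ++ v) (φι≡ι′ (inj₂ c))
            (concatMap-insertPrefixes φ ι ι′ φι≡ι′ P′ v) ⟩
    concatMap φ P ++ ι′ (inj₂ c) ∷ insertPrefixes ι′ (concatMap φ P′) v
  ≡⟨ cong (λ Q → concatMap φ P ++ ι′ (inj₂ c) ∷ insertPrefixes ι′ Q v) concatMap-P′ ⟩
    concatMap φ P ++ ι′ (inj₂ c) ∷ insertPrefixes ι′ (concatMap φ P ∷ʳ ι′ (inj₁ c)) v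
  ∎
  where
  open ≡-Reasoning
  P′ = P ∷ʳ ι (inj₁ c)
  concatMap-P′ : concatMap φ P′ ≡ concatMap φ P ∷ʳ ι′ (inj₁ c)
  concatMap-P′ = trans (concatMap-++ φ P [ ι (inj₁ c) ])
                       (cong (concatMap φ P ++_) (trans (++-identityʳ _) (φι≡ι′ (inj₁ c))))

underlineAt-++ : ∀ {n} (P : Word n) k w → underlineAt (length P + k) (P ++ w) ≡ map inj₁ P ++ underlineAt k w
underlineAt-++ []      k w = refl
underlineAt-++ (a ∷ P) k w = cong (inj₁ a ∷_) (underlineAt-++ P k w)

squaring-suffixBlocks : ∀ {n} (P w : Word n) →
                        concatMap (λ i → underlineAt i (P ++ w)) (applyUpTo (length P +_) (length w))
                        ≡ insertPrefixes id (map inj₁ P) (suffixBlocks w)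
squaring-suffixBlocks P []      = refl
squaring-suffixBlocks P (c ∷ w) = begin
    underlineAt (length P + 0) (P ++ c ∷ w) ++ blocks (P ++ c ∷ w) (λ i → length P + suc i)
  ≡⟨ cong₂ _++_ (underlineAt-++ P 0 (c ∷ w)) shift ⟩
    (map inj₁ P ++ block) ++ blocks ((P ∷ʳ c) ++ w) (length (P ∷ʳ c) +_)
  ≡⟨ cong ((map inj₁ P ++ block) ++_) (squaring-suffixBlocks (P ∷ʳ c) w) ⟩
    (map inj₁ P ++ block) ++ insertPrefixes id (map inj₁ (P ∷ʳ c)) (suffixBlocks w)
  ≡⟨ ++-assoc (map inj₁ P) block _ ⟩
    map inj₁ P ++ block ++ insertPrefixes id (map inj₁ (P ∷ʳ c)) (suffixBlocks w)
  ≡⟨ cong (λ Q → map inj₁ P ++ block ++ insertPrefixes id Q (suffixBlocks w)) (map-++ inj₁ P [ c ]) ⟩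
    map inj₁ P ++ block ++ insertPrefixes id (map inj₁ P ∷ʳ inj₁ c) (suffixBlocks w)
  ≡⟨ cong (λ v → map inj₁ P ++ inj₂ c ∷ v)
          (insertPrefixes-plain id (map inj₁ P ∷ʳ inj₁ c) w (suffixBlocks w)) ⟨
    insertPrefixes id (map inj₁ P) (suffixBlocks (c ∷ w))
  ∎
  where
  open ≡-Reasoning

  block : List (Fin _ ⊎ Fin _)
  block = inj₂ c ∷ map inj₁ w

  blocks : Word _ → (ℕ → ℕ) → List (Fin _ ⊎ Fin _)
  blocks u offset = concatMap (λ i → underlineAt i u) (applyUpTo offset (length w))

  shift : blocks (P ++ c ∷ w) (λ i → length P + suc i) ≡ blocks ((P ∷ʳ c) ++ w) (length (P ∷ʳ c) +_)
  shift = cong₂ (λ u is → concatMap (λ i → underlineAt i u) is) (sym (++-assoc P [ c ] w))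
                (applyUpTo-cong (λ i → sym (trans (cong (_+ i) (length-++ P {[ c ]})) (+-assoc (length P) 1 i)))
                                (length w))

-- In both systems below the cursor emits what the letter just read contributes,
-- and each slot collects copies of letters.
data Marker : Set where
  cursor slot : Marker

finite-Marker : Finite Marker
finite-Marker = 2 , mk↔ₛ′ toFin fromFin toFin∘fromFin fromFin∘toFin
  where
  toFin : Marker → Fin 2
  toFin cursor = zero
  toFin slot   = suc zero

  fromFin : Fin 2 → Marker
  fromFin zero       = cursor
  fromFin (suc zero) = slot

  toFin∘fromFin : ∀ i → toFin (fromFin i) ≡ i
  toFin∘fromFin zero       = refl
  toFin∘fromFin (suc zero) = refl

  fromFin∘toFin : ∀ m → fromFin (toFin m) ≡ m
  fromFin∘toFin cursor = refl
  fromFin∘toFin slot   = refl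

module Squaring (n : ℕ) where

  Δ : Set
  Δ = (Fin n ⊎ Fin n) ⊎ Marker

  finite-Δ : Finite Δ
  finite-Δ = finite-⊎ (finite-⊎ (finite-Fin n) (finite-Fin n)) finite-Marker

  plain underlined : Fin n → Δ
  plain      = inj₁ ∘ inj₁
  underlined = inj₁ ∘ inj₂

  encode : Fin n ⊎ Fin n → Fin (n + n)
  encode = join n n

  decode : Fin (n + n) → Fin n ⊎ Fin n
  decode = splitAt n

  erase : Δ → Word (n + n)
  erase (inj₁ y) = [ encode y ]
  erase (inj₂ _) = []

  appendLetter : Fin n → Δ → List Δ
  appendLetter c (inj₁ y)      = [ inj₁ y ]
  appendLetter c (inj₂ slot)   = plain c ∷ inj₂ slot ∷ []
  appendLetter c (inj₂ cursor) = underlined c ∷ inj₂ slot ∷ inj₂ cursor ∷ []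

  markedSuffixBlocks : Word n → List Δ
  markedSuffixBlocks []      = [ inj₂ cursor ]
  markedSuffixBlocks (a ∷ p) = underlined a ∷ map plain p ++ inj₂ slot ∷ markedSuffixBlocks p

  appendLetter-marked : ∀ c p →
                        concatMap (appendLetter c) (markedSuffixBlocks p) ≡ markedSuffixBlocks (p ∷ʳ c)
  appendLetter-marked c []      = refl
  appendLetter-marked c (a ∷ p) = cong (underlined a ∷_) (begin
      concatMap (appendLetter c) (map plain p ++ inj₂ slot ∷ markedSuffixBlocks p)
    ≡⟨ concatMap-++ (appendLetter c) (map plain p) _ ⟩
      concatMap (appendLetter c) (map plain p)
        ++ plain c ∷ inj₂ slot ∷ concatMap (appendLetter c) (markedSuffixBlocks p)
    ≡⟨ cong₂ (λ u v → u ++ plain c ∷ inj₂ slot ∷ v) fixes-plain (appendLetter-marked c p) ⟩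
      map plain p ++ plain c ∷ inj₂ slot ∷ markedSuffixBlocks (p ∷ʳ c)
    ≡⟨ ++-assoc (map plain p) [ plain c ] _ ⟨
      (map plain p ∷ʳ plain c) ++ inj₂ slot ∷ markedSuffixBlocks (p ∷ʳ c)
    ≡⟨ cong (_++ inj₂ slot ∷ markedSuffixBlocks (p ∷ʳ c)) (map-++ plain p [ c ]) ⟨
      map plain (p ∷ʳ c) ++ inj₂ slot ∷ markedSuffixBlocks (p ∷ʳ c)
    ∎)
    where
    open ≡-Reasoning
    fixes-plain : concatMap (appendLetter c) (map plain p) ≡ map plain p
    fixes-plain = trans (concatMap-map (appendLetter c) plain p) (concatMap-singleton plain p)

  appendLetter-run : ∀ x → applyMorphisms appendLetter [ inj₂ cursor ] x ≡ markedSuffixBlocks (reverse x)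
  appendLetter-run []      = refl
  appendLetter-run (c ∷ x) = begin
      concatMap (appendLetter c) (applyMorphisms appendLetter [ inj₂ cursor ] x)
    ≡⟨ cong (concatMap (appendLetter c)) (appendLetter-run x) ⟩
      concatMap (appendLetter c) (markedSuffixBlocks (reverse x))
    ≡⟨ appendLetter-marked c (reverse x) ⟩
      markedSuffixBlocks (reverse x ∷ʳ c)
    ≡⟨ cong markedSuffixBlocks (unfold-reverse c x) ⟨
      markedSuffixBlocks (reverse (c ∷ x))
    ∎
    where open ≡-Reasoning

  erase-marked : ∀ p → concatMap erase (markedSuffixBlocks p) ≡ map encode (suffixBlocks p)
  erase-marked []      = refl
  erase-marked (a ∷ p) = cong (encode (inj₂ a) ∷_) (begin
      concatMap erase (map plain p ++ inj₂ slot ∷ markedSuffixBlocks p)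
    ≡⟨ concatMap-++ erase (map plain p) _ ⟩
      concatMap erase (map plain p) ++ concatMap erase (markedSuffixBlocks p)
    ≡⟨ cong₂ _++_ (trans (concatMap-map erase plain p) (concatMap-singleton (encode ∘ inj₁) p))
                  (erase-marked p) ⟩
      map (encode ∘ inj₁) p ++ map encode (suffixBlocks p)
    ≡⟨ cong (_++ map encode (suffixBlocks p)) (map-∘ p) ⟩
      map encode (map inj₁ p) ++ map encode (suffixBlocks p)
    ≡⟨ map-++ encode (map inj₁ p) (suffixBlocks p) ⟨
      map encode (map inj₁ p ++ suffixBlocks p)
    ∎)
    where open ≡-Reasoning

  suffixBlocks⇒HDT0L : HDT0LFun (map encode ∘ suffixBlocks ∘ reverse)
  suffixBlocks⇒HDT0L = HDT0LFun-overFinite finite-Δ [ inj₂ cursor ] appendLetter erase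
    (λ x → trans (cong (concatMap erase) (appendLetter-run x)) (erase-marked (reverse x)))

  prefixLetter : Fin n ⊎ Fin n → Δ → List Δ
  prefixLetter e        (inj₁ y)      = [ inj₁ y ]
  prefixLetter (inj₁ c) (inj₂ cursor) = inj₂ cursor ∷ plain c ∷ []
  prefixLetter (inj₂ c) (inj₂ cursor) = inj₂ cursor ∷ inj₂ slot ∷ underlined c ∷ []
  prefixLetter (inj₁ c) (inj₂ slot)   = inj₂ slot ∷ []
  prefixLetter (inj₂ c) (inj₂ slot)   = inj₂ slot ∷ plain c ∷ []

  prefixLetter-run : ∀ v → applyMorphisms (prefixLetter ∘ decode) [ inj₂ cursor ] v
                         ≡ inj₂ cursor ∷ insertPrefixes inj₁ [ inj₂ slot ] (map decode v)
  prefixLetter-run []      = refl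
  prefixLetter-run (e ∷ v) = begin
      concatMap (prefixLetter (decode e)) (applyMorphisms (prefixLetter ∘ decode) [ inj₂ cursor ] v)
    ≡⟨ cong (concatMap (prefixLetter (decode e))) (prefixLetter-run v) ⟩
      prefixLetter (decode e) (inj₂ cursor)
        ++ concatMap (prefixLetter (decode e)) (insertPrefixes inj₁ [ inj₂ slot ] u)
    ≡⟨ cong (prefixLetter (decode e) (inj₂ cursor) ++_)
            (concatMap-insertPrefixes (prefixLetter (decode e)) inj₁ inj₁ (λ _ → refl) [ inj₂ slot ] u) ⟩
      prefixLetter (decode e) (inj₂ cursor) ++ insertPrefixes inj₁ (prefixLetter (decode e) (inj₂ slot) ++ []) u
    ≡⟨ emit (decode e) ⟩
      inj₂ cursor ∷ insertPrefixes inj₁ [ inj₂ slot ] (decode e ∷ u)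
    ∎
    where
    open ≡-Reasoning
    u = map decode v
    emit : ∀ e′ → prefixLetter e′ (inj₂ cursor)
                    ++ insertPrefixes inj₁ (prefixLetter e′ (inj₂ slot) ++ []) u
                ≡ inj₂ cursor ∷ insertPrefixes inj₁ [ inj₂ slot ] (e′ ∷ u)
    emit (inj₁ c) = refl
    emit (inj₂ c) = refl

  insertPrefixes⇒HDT0L : HDT0LFun (insertPrefixes encode [] ∘ map decode)
  insertPrefixes⇒HDT0L = HDT0LFun-overFinite finite-Δ [ inj₂ cursor ] (prefixLetter ∘ decode) erase
    (λ v → trans (cong (concatMap erase) (prefixLetter-run v))
                 (concatMap-insertPrefixes erase inj₁ encode (λ _ → refl) [ inj₂ slot ] (map decode v)))

  squaring-stages : ∀ w → squaring n w
                          ≡ insertPrefixes encode [] (map decode (map encode (suffixBlocks (reverse (reverse w)))))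
  squaring-stages w = begin
      map encode (concatMap (λ i → underlineAt i w) (upTo (length w)))
    ≡⟨ cong (map encode) (squaring-suffixBlocks [] w) ⟩
      map encode (insertPrefixes id [] (suffixBlocks w))
    ≡⟨ concatMap-singleton encode _ ⟨
      concatMap ([_] ∘ encode) (insertPrefixes id [] (suffixBlocks w))
    ≡⟨ concatMap-insertPrefixes ([_] ∘ encode) id encode (λ _ → refl) [] (suffixBlocks w) ⟩
      insertPrefixes encode [] (suffixBlocks w)
    ≡⟨ cong (insertPrefixes encode []) (decode-encode (suffixBlocks w)) ⟨
      insertPrefixes encode [] (map decode (map encode (suffixBlocks w)))
    ≡⟨ cong (insertPrefixes encode [] ∘ map decode ∘ map encode ∘ suffixBlocks) (reverse-involutive w) ⟨
      insertPrefixes encode [] (map decode (map encode (suffixBlocks (reverse (reverse w)))))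
    ∎
    where
    open ≡-Reasoning
    decode-encode : ∀ u → map decode (map encode u) ≡ u
    decode-encode u = trans (sym (map-∘ u)) (trans (map-cong (splitAt-join n n) u) (map-id u))

  squaring⇒HDT0LComposition : HDT0LComposition (squaring n)
  squaring⇒HDT0LComposition =
    after (after reversal-stage suffixBlocks⇒HDT0L (λ _ → refl)) insertPrefixes⇒HDT0L squaring-stages
    where
    reversal-stage : HDT0LComposition reverse
    reversal-stage =
      HDT0LComposition-cong reverse≗⟦reversal⟧ (single (registerTransducer⇒HDT0L (reversal n)))

open Squaring using (squaring⇒HDT0LComposition)

theorem20 : ∀ {n m : ℕ} (f : StrFun n m) → Polyregular f → HDT0LComposition f
theorem20 f (reg (T , _ , ⟦T⟧≗f)) =
  HDT0LComposition-cong (sym ∘ ⟦T⟧≗f) (single (registerTransducer⇒HDT0L T))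
theorem20 f (sq f≗squaring) =
  HDT0LComposition-cong f≗squaring (squaring⇒HDT0LComposition _)
theorem20 f (comp pg ph f≗h∘g) =
  HDT0LComposition-∘ (theorem20 _ pg) (theorem20 _ ph) f≗h∘g
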